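{- For any star graph $K_{1,n}$ on $n+1$ vertices with $n\ge 2$, we have $\gamma_t(M(K_{1,n}))=n$.
   Context: All graphs are finite and simple. $K_{1,n}$ is the star: one central vertex adjacent to $n$ other vertices, with no further edges. For a graph $H$ with no isolated vertices, a total dominating set of $H$ is a set $S\subseteq V(H)$ such that every vertex of $H$ has at least one neighbor in $S$; $\gamma_t(H)$ is the minimum cardinality of a total dominating set. The middle graph $M(G)$ of a graph $G$ has vertex set $V(G)\cup E(G)$ (disjoint union), and two of its vertices $x,y$ are adjacent exactly when either $x,y\in E(G)$ are edges of $G$ sharing a common endpoint, or $x\in V(G)$, $y\in E(G)$ and $x$ is an endpoint of $y$ (no two elements of $V(G)$ are adjacent in $M(G)$). -}

module Defs where

open import Data.Nat using (ℕ; zero; suc)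
open import Data.Fin using (Fin; zero; suc; _<_)
open import Data.Bool using (Bool; true; false; T)
open import Data.Product using (Σ; _×_; _,_; ∃-syntax; proj₁; proj₂)
open import Data.Sum using (_⊎_; inj₁; inj₂)
open import Data.Empty using (⊥)
open import Data.List using (List; length)
open import Data.List.Membership.Propositional using (_∈_)
open import Data.List.Relation.Unary.Unique.Propositional using (Unique)
open import Relation.Binary.PropositionalEquality using (_≡_; _≢_)

record Graph (n : ℕ) : Set where
  field
    adj   : Fin n → Fin n → Bool
    sym   : ∀ u v → adj u v ≡ adj v u
    irrfl : ∀ u → adj u u ≡ false
open Graph public

-- Edges of G: unordered pairs {u,v}, represented canonically by u < v.
Edge : ∀ {n} → Graph n → Set
Edge {n} G = Σ (Fin n × Fin n) λ p → (proj₁ p < proj₂ p) × T (adj G (proj₁ p) (proj₂ p))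

_isEndOf_ : ∀ {n} {G : Graph n} → Fin n → Edge G → Set
x isEndOf ((u , v) , _) = (x ≡ u) ⊎ (x ≡ v)

record AbsGraph : Set₁ where
  field
    Vtx : Set
    _~_ : Vtx → Vtx → Set
open AbsGraph public

MiddleAdj : ∀ {n} (G : Graph n) → (Fin n ⊎ Edge G) → (Fin n ⊎ Edge G) → Set
MiddleAdj G (inj₁ x) (inj₁ y) = ⊥
MiddleAdj G (inj₁ x) (inj₂ e) = _isEndOf_ {G = G} x e
MiddleAdj G (inj₂ e) (inj₁ y) = _isEndOf_ {G = G} y e
MiddleAdj G (inj₂ e) (inj₂ f) = (e ≢ f) × (∃[ w ] (_isEndOf_ {G = G} w e × _isEndOf_ {G = G} w f))

Middle : ∀ {n} → Graph n → AbsGraph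
Middle {n} G = record { Vtx = Fin n ⊎ Edge G ; _~_ = MiddleAdj G }

-- The star K_{1,n}: vertices Fin (suc n), centre 0, leaves 1..n.
starAdj : ∀ {n} → Fin (suc n) → Fin (suc n) → Bool
starAdj zero    zero    = false
starAdj zero    (suc _) = true
starAdj (suc _) zero    = true
starAdj (suc _) (suc _) = false

starSym : ∀ {n} (u v : Fin (suc n)) → starAdj u v ≡ starAdj v u
starSym zero zero = Relation.Binary.PropositionalEquality.refl
starSym zero (suc _) = Relation.Binary.PropositionalEquality.refl
starSym (suc _) zero = Relation.Binary.PropositionalEquality.refl
starSym (suc _) (suc _) = Relation.Binary.PropositionalEquality.refl

starIrr : ∀ {n} (u : Fin (suc n)) → starAdj u u ≡ false
starIrr zero = Relation.Binary.PropositionalEquality.refl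
starIrr (suc _) = Relation.Binary.PropositionalEquality.refl

Star : (n : ℕ) → Graph (suc n)
Star n = record { adj = starAdj ; sym = starSym ; irrfl = starIrr }

-- Total dominating set (as a duplicate-free list; its cardinality is its length):
-- every vertex has a neighbour in S.
IsTotalDominating : (H : AbsGraph) → List (Vtx H) → Set
IsTotalDominating H S = ∀ v → ∃[ s ] (s ∈ S × (_~_ H v s))

TotalDominationNumber≡ : AbsGraph → ℕ → Set
TotalDominationNumber≡ H k =
  (∃[ S ] (Unique S × IsTotalDominating H S × length S ≡ k)) ×
  (∀ S → Unique S → IsTotalDominating H S → k Data.Nat.≤ length S)

-- Each leaf of K_{1,n} is adjacent in M(K_{1,n}) only to its own spoke (the
-- edge joining it to the centre), so every total dominating set contains all
-- n spokes. Conversely the spokes dominate every vertex of V(K_{1,n}) and,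
-- all sharing the centre, form a clique; for n ≥ 2 every spoke therefore has
-- another spoke as neighbour, and the n spokes are a total dominating set.
module Submission where

open import Level using (Level)
open import Defs hiding (sym)
open import Data.Nat using (ℕ; suc; _≤_; _≥_; z≤n; s≤s)
open import Data.Fin using (Fin; zero; suc)
open import Data.Fin.Properties using (injective⇒≤)
open import Data.Unit using (tt)
open import Data.Product using (_,_; ∃-syntax)
open import Data.Sum using (_⊎_; inj₁; inj₂)
open import Data.Sum.Properties using (inj₂-injective)
open import Data.List using (List; tabulate; lookup; length)
open import Data.List.Properties using (length-tabulate)
open import Data.List.Membership.Propositional using (_∈_)
open import Data.List.Membership.Propositional.Properties using (∈-tabulate⁺)
open import Data.List.Relation.Unary.Any using (index)
open import Data.List.Relation.Unary.Any.Properties using (lookup-index)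
open import Data.List.Relation.Unary.Unique.Propositional using (Unique)
open import Data.List.Relation.Unary.Unique.Propositional.Properties using (tabulate⁺)
open import Function using (_∘_)
open import Function.Definitions using (Injective)
open import Relation.Binary.PropositionalEquality using (_≡_; _≢_; refl; cong; sym; module ≡-Reasoning)

private
  variable
    a : Level
    A : Set a
    m n : ℕ

injective-∈⇒≤-length : {xs : List A} {f : Fin n → A} →
                       Injective _≡_ _≡_ f → (∀ i → f i ∈ xs) → n ≤ length xs
injective-∈⇒≤-length {xs = xs} {f} f-injective f∈xs = injective⇒≤ index-injective
  where
  index-injective : Injective _≡_ _≡_ (index ∘ f∈xs)
  index-injective {i} {j} eq = f-injective (begin
    f i                        ≡⟨ lookup-index (f∈xs i) ⟩
    lookup xs (index (f∈xs i)) ≡⟨ cong (lookup xs) eq ⟩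
    lookup xs (index (f∈xs j)) ≡⟨ sym (lookup-index (f∈xs j)) ⟩
    f j                        ∎)
    where open ≡-Reasoning

other : Fin (suc (suc m)) → Fin (suc (suc m))
other zero    = suc zero
other (suc _) = zero

other≢ : (i : Fin (suc (suc m))) → i ≢ other i
other≢ zero    ()
other≢ (suc _) ()

spoke : Fin n → Edge (Star n)
spoke i = (zero , suc i) , s≤s z≤n , tt

spoke-injective : Injective _≡_ _≡_ (spoke {n})
spoke-injective refl = refl

spoke-surjective : (e : Edge (Star n)) → ∃[ i ] e ≡ spoke i
spoke-surjective ((zero  , suc i) , s≤s z≤n , tt) = i , refl
spoke-surjective ((zero  , zero)  , () , _)
spoke-surjective ((suc _ , zero)  , () , _)
spoke-surjective ((suc _ , suc _) , _  , ())

leaf-isEndOf⇒spoke : (i : Fin n) (e : Edge (Star n)) →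
                     _isEndOf_ {G = Star n} (suc i) e → e ≡ spoke i
leaf-isEndOf⇒spoke i e i∈e with spoke-surjective e
... | j , refl with i∈e
...   | inj₁ ()
...   | inj₂ refl = refl

spoke-adjacent : {i j : Fin n} → i ≢ j → MiddleAdj (Star n) (inj₂ (spoke i)) (inj₂ (spoke j))
spoke-adjacent i≢j = (i≢j ∘ spoke-injective) , zero , inj₁ refl , inj₁ refl

spokes : (n : ℕ) → List (Fin (suc n) ⊎ Edge (Star n))
spokes n = tabulate (inj₂ ∘ spoke)

spokes-unique : Unique (spokes n)
spokes-unique = tabulate⁺ (spoke-injective ∘ inj₂-injective)

spoke∈spokes : (i : Fin n) → inj₂ (spoke i) ∈ spokes n
spoke∈spokes = ∈-tabulate⁺

spokes-totalDominating : IsTotalDominating (Middle (Star (suc (suc m)))) (spokes (suc (suc m)))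
spokes-totalDominating (inj₁ zero)    = inj₂ (spoke zero) , spoke∈spokes zero , inj₁ refl
spokes-totalDominating (inj₁ (suc i)) = inj₂ (spoke i) , spoke∈spokes i , inj₂ refl
spokes-totalDominating (inj₂ e) with spoke-surjective e
... | i , refl = inj₂ (spoke (other i)) , spoke∈spokes (other i) , spoke-adjacent (other≢ i)

spoke∈totalDominating : {S : List (Fin (suc n) ⊎ Edge (Star n))} →
                        IsTotalDominating (Middle (Star n)) S → ∀ i → inj₂ (spoke i) ∈ S
spoke∈totalDominating dom i with dom (inj₁ (suc i))
... | inj₁ _ , _   , ()
... | inj₂ e , e∈S , i∈e with leaf-isEndOf⇒spoke i e i∈e
...   | refl = e∈S

proposition2p3 : (n : ℕ) → n ≥ 2 → TotalDominationNumber≡ (Middle (Star n)) n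
proposition2p3 n@(suc (suc _)) (s≤s (s≤s z≤n)) =
  (spokes n , spokes-unique , spokes-totalDominating , length-tabulate (inj₂ ∘ spoke)) ,
  λ S _ dom → injective-∈⇒≤-length (spoke-injective ∘ inj₂-injective) (spoke∈totalDominating dom)
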